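{- Let $n>1$ be a square-free positive integer. Let $\sigma$ be the cycle $(2\,3\,\cdots\,n)$ in the symmetric group on $\{1,\dots,n\}$, and for $0\le i\le n-2$ let $F_i$ be the $n\times n$ permutation matrix of $\sigma^i$. Then $\{F_0,\dots,F_{n-2}\}$ is a maximal set of $n-1$ mutually orthogonal binary frequency squares of type $(n;n-1,1)$.
   Context: A frequency square of type $(n;\lambda_0,\dots,\lambda_{m-1})$ (with $m\ge 2$, all $\lambda_i\ge1$, $\sum\lambda_i=n$) is an $n\times n$ array on symbols $\{0,\dots,m-1\}$ in which symbol $i$ occurs exactly $\lambda_i$ times in each row and each column. It is binary if $m=2$. Two frequency squares $F,F'$ of types $(n;\lambda_0,\dots,\lambda_{m_1-1})$ and $(n;\mu_0,\dots,\mu_{m_2-1})$ are orthogonal if, when superimposed, each ordered pair $(i,j)$ occurs in exactly $\lambda_i\mu_j$ cells. A set of mutually orthogonal frequency squares (MOFS) is a set of pairwise orthogonal frequency squares. A set $\{F_1,\dots,F_k\}$ of MOFS is maximal if there is no frequency square $F$ (of any type, with at least two symbols) that is orthogonal to $F_i$ for every $1\le i\le k$. -}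

module Defs where

open import Data.Nat using (ℕ; zero; suc; _+_; _*_; _∸_; _≤_; _<_; _≡ᵇ_; _<ᵇ_)
open import Data.Nat.Divisibility using (_∣_)
open import Data.Nat.Primality using (Prime)
open import Data.Fin using (Fin; zero; suc; toℕ; _≟_)
open import Data.Bool using (Bool; true; false; if_then_else_)
open import Data.Product using (_×_; Σ)
open import Relation.Binary.PropositionalEquality using (_≡_; _≢_)
open import Relation.Nullary using (¬_)
open import Relation.Nullary.Decidable using (⌊_⌋)
open import Data.Bool using (_∧_)

sumFin : ∀ {k} → (Fin k → ℕ) → ℕ
sumFin {zero}  f = 0
sumFin {suc k} f = f zero + sumFin (λ x → f (suc x))

count : ∀ {k} → (Fin k → Bool) → ℕ
count P = sumFin (λ x → if P x then 1 else 0)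

countCells : ∀ {n} → (Fin n → Fin n → Bool) → ℕ
countCells {n} P = sumFin (λ r → count (P r))

Square : ℕ → ℕ → Set
Square n m = Fin n → Fin n → Fin m

IsFreqSquare : (n m : ℕ) → (Fin m → ℕ) → Square n m → Set
IsFreqSquare n m lam F =
  (2 ≤ m) × (∀ i → 1 ≤ lam i) × (sumFin lam ≡ n) ×
  (∀ r s → count (λ c → ⌊ F r c ≟ s ⌋) ≡ lam s) ×
  (∀ c s → count (λ r → ⌊ F r c ≟ s ⌋) ≡ lam s)

Orthogonal : ∀ {n m₁ m₂} → Square n m₁ → Square n m₂ →
             (Fin m₁ → ℕ) → (Fin m₂ → ℕ) → Set
Orthogonal F F' lam mu =
  ∀ i j → countCells (λ r c → ⌊ F r c ≟ i ⌋ ∧ ⌊ F' r c ≟ j ⌋) ≡ lam i * mu j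

SquareFree : ℕ → Set
SquareFree n = ∀ p → Prime p → ¬ (p * p ∣ n)

-- The cycle σ = (2 3 ⋯ n) on {1,…,n}, written 0-indexed on {0,…,n-1}:
-- 0 is fixed, k ↦ k+1 for 1 ≤ k ≤ n-2, and n-1 ↦ 1.
sigma : ℕ → ℕ → ℕ
sigma n zero    = zero
sigma n (suc k) = if suc (suc k) <ᵇ n then suc (suc k) else 1

sigmaPow : ℕ → ℕ → ℕ → ℕ
sigmaPow n zero    k = k
sigmaPow n (suc i) k = sigma n (sigmaPow n i k)

permSq : (n i : ℕ) → Square n 2
permSq n i r c = if toℕ c ≡ᵇ sigmaPow n i (toℕ r) then suc zero else zero

binType : ℕ → Fin 2 → ℕ
binType n zero    = n ∸ 1
binType n (suc _) = 1

{-# OPTIONS --safe #-}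
module Submission where

-- σ fixes 0 and rotates the other m = n − 1 points: σⁱ(1 + a) = 1 + (i + a) mod m.
-- Hence every Fᵢ is a permutation matrix, two distinct Fᵢ meet only in the cell
-- (0,0), and on the block of rows and columns 1, …, m the Fᵢ (0 ≤ i < m) have
-- disjoint supports covering the block.  Suppose G is orthogonal to all Fᵢ and pick
-- a symbol j ≠ G(0,0), occurring μ ≥ 1 times in each row and column of G.  Each Fᵢ
-- meets j in exactly μ cells, all inside the block, so the block holds m·μ copies
-- of j, while row 0 and column 0 hold 2μ more: n·μ = (m + 2)·μ forces μ = 0.

open import Defs
open import Data.Bool using (Bool; true; false; if_then_else_; T; _∧_; not)
open import Data.Bool.Properties using (T-∧; ∧-comm; ∧-identityʳ; ∧-zeroʳ)
open import Data.Fin using (Fin; zero; suc; toℕ; _≟_; punchIn)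
open import Data.Fin.Properties using (toℕ<n; toℕ≤pred[n]; punchInᵢ≢i)
open import Data.Nat
  using (ℕ; zero; suc; _+_; _*_; _∸_; _≤_; _<_; _≡ᵇ_; _<ᵇ_; z≤n; s≤s; z<s; s<s; NonZero)
open import Data.Nat.DivMod
  using (_%_; %-congˡ; m%n%n≡m%n; %-distribˡ-+; m%n<n; m%n≤n; m<n⇒m%n≡m; n%n≡0; %-remove-+ˡ)
open import Data.Nat.Divisibility using (_∣_; m%n≡0⇒n∣m)
open import Data.Nat.Properties
  using ( suc-injective; +-comm; +-assoc; +-cancelˡ-≡; +-cancelʳ-≡; *-identityˡ; *-identityʳ; *-zeroʳ
        ; ≡ᵇ⇒≡; ≡⇒≡ᵇ; <ᵇ⇒<; <⇒<ᵇ; 0≢1+n; 1+n≢0; <⇒≢; ≤-antisym; ≮⇒≥; m∸n+n≡m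
        ; +-0-commutativeMonoid )
open import Algebra.Properties.CommutativeMonoid.Sum +-0-commutativeMonoid
  using (sum; ∑-distrib-+; ∑-comm)
open import Data.Product using (_×_; Σ; _,_; proj₁; proj₂; ∃-syntax)
open import Data.Unit using (tt)
open import Function using (_∘_; Equivalence)
open import Relation.Binary.PropositionalEquality
  using (_≡_; _≢_; refl; sym; trans; cong; cong₂; subst; module ≡-Reasoning)
open import Relation.Nullary using (¬_; contradiction)
open import Relation.Nullary.Decidable using (⌊_⌋; isYes≗does; dec-false)

open ≡-Reasoning
open Equivalence using (to; from)

sumFin≡sum : ∀ {k} (f : Fin k → ℕ) → sumFin f ≡ sum f
sumFin≡sum {zero}  f = refl
sumFin≡sum {suc k} f = cong (f zero +_) (sumFin≡sum (f ∘ suc))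

sumFin-cong : ∀ {k} {f g : Fin k → ℕ} → (∀ x → f x ≡ g x) → sumFin f ≡ sumFin g
sumFin-cong {zero}  eq = refl
sumFin-cong {suc k} eq = cong₂ _+_ (eq zero) (sumFin-cong (eq ∘ suc))

sumFin-const : ∀ {k} {f : Fin k → ℕ} {c} → (∀ x → f x ≡ c) → sumFin f ≡ k * c
sumFin-const {zero}  eq = refl
sumFin-const {suc k} eq = cong₂ _+_ (eq zero) (sumFin-const (eq ∘ suc))

sumFin-distrib-+ : ∀ {k} (f g : Fin k → ℕ) → sumFin (λ x → f x + g x) ≡ sumFin f + sumFin g
sumFin-distrib-+ f g = begin
  sumFin (λ x → f x + g x)  ≡⟨ sumFin≡sum (λ x → f x + g x) ⟩
  sum (λ x → f x + g x)     ≡⟨ ∑-distrib-+ f g ⟩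
  sum f + sum g             ≡⟨ cong₂ _+_ (sumFin≡sum f) (sumFin≡sum g) ⟨
  sumFin f + sumFin g       ∎

sumFin-comm : ∀ {a b} (f : Fin a → Fin b → ℕ) →
              sumFin (λ i → sumFin (f i)) ≡ sumFin (λ j → sumFin (λ i → f i j))
sumFin-comm f = begin
  sumFin (λ i → sumFin (f i))          ≡⟨ sumFin²≡sum² f ⟩
  sum (λ i → sum (f i))                ≡⟨ ∑-comm f ⟩
  sum (λ j → sum (λ i → f i j))        ≡⟨ sumFin²≡sum² (λ j i → f i j) ⟨
  sumFin (λ j → sumFin (λ i → f i j))  ∎
  where
  sumFin²≡sum² : ∀ {a b} (h : Fin a → Fin b → ℕ) →
                 sumFin (λ i → sumFin (h i)) ≡ sum (λ i → sum (h i))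
  sumFin²≡sum² h = trans (sumFin-cong (λ i → sumFin≡sum (h i))) (sumFin≡sum (λ i → sum (h i)))

count-cong : ∀ {k} {P Q : Fin k → Bool} → (∀ x → P x ≡ Q x) → count P ≡ count Q
count-cong eq = sumFin-cong (λ x → cong (λ b → if b then 1 else 0) (eq x))

count-none : ∀ {k} (P : Fin k → Bool) → (∀ x → ¬ T (P x)) → count P ≡ 0
count-none {zero}  P none = refl
count-none {suc k} P none with P zero | none zero
... | false | _  = count-none (P ∘ suc) (none ∘ suc)
... | true  | ¬⊤ = contradiction tt ¬⊤

count-unique : ∀ {d} (P : ℕ → Bool) {x} → x < d → T (P x) →
               (∀ {y} → y < d → T (P y) → y ≡ x) → count {d} (P ∘ toℕ) ≡ 1
count-unique {suc d} P {zero} _ Px unique with P zero | Px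
... | true  | _  = cong suc (count-none _ (λ y Py → 1+n≢0 (unique (s<s (toℕ<n y)) Py)))
... | false | ()
count-unique {suc d} P {suc x} (s<s x<d) Px unique with P zero | unique z<s
... | false | _   = count-unique (P ∘ suc) x<d Px (λ y<d Py → suc-injective (unique (s<s y<d) Py))
... | true  | 0≡x = contradiction (0≡x tt) 0≢1+n

count-∧ʳ : ∀ {k} (P : Fin k → Bool) b → count (λ x → P x ∧ b) ≡ (if b then count P else 0)
count-∧ʳ P true  = count-cong (λ x → ∧-identityʳ (P x))
count-∧ʳ {k} P false =
  trans (count-cong (λ x → ∧-zeroʳ (P x))) (count-none {k} (λ _ → false) (λ _ ()))

count-split : ∀ {k} (P Q : Fin k → Bool) →
              count P ≡ count (λ x → P x ∧ Q x) + count (λ x → P x ∧ not (Q x))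
count-split {k} P Q = trans (sumFin-cong (λ x → split (P x) (Q x))) (sumFin-distrib-+ {k} _ _)
  where
  split : ∀ p q → (if p then 1 else 0) ≡ (if p ∧ q then 1 else 0) + (if p ∧ not q then 1 else 0)
  split false _     = refl
  split true  false = refl
  split true  true  = refl

count-not : ∀ {k} (P : Fin (suc k) → Bool) → count P ≡ 1 → count (not ∘ P) ≡ k
count-not {k} P P≡1 = suc-injective (begin
  suc (count (not ∘ P))       ≡⟨ cong (_+ count (not ∘ P)) P≡1 ⟨
  count P + count (not ∘ P)   ≡⟨ count-split (λ _ → true) P ⟨
  count {suc k} (λ _ → true)  ≡⟨ sumFin-const {suc k} (λ _ → refl) ⟩
  suc k * 1                   ≡⟨ *-identityʳ (suc k) ⟩
  suc k                       ∎)

countCells-cong : ∀ {n} {P Q : Fin n → Fin n → Bool} → (∀ r c → P r c ≡ Q r c) →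
                  countCells P ≡ countCells Q
countCells-cong eq = sumFin-cong (λ r → count-cong (eq r))

countCells-split : ∀ {n} (P Q : Fin n → Fin n → Bool) →
                   countCells P ≡ countCells (λ r c → P r c ∧ Q r c)
                                + countCells (λ r c → P r c ∧ not (Q r c))
countCells-split {n} P Q =
  trans (sumFin-cong (λ r → count-split (P r) (Q r))) (sumFin-distrib-+ {n} _ _)

countCells-border : ∀ {n} (P : Fin (suc n) → Fin (suc n) → Bool) →
                    countCells P ≡ count (P zero) + (count (λ r → P (suc r) zero)
                                                     + countCells (λ r c → P (suc r) (suc c)))
countCells-border {n} P = cong (count (P zero) +_) (sumFin-distrib-+ {n} _ _)

countCells-inner : ∀ {n} (P : Fin (suc n) → Fin (suc n) → Bool) →
                   (∀ c → ¬ T (P zero c)) → (∀ r → ¬ T (P (suc r) zero)) →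
                   countCells P ≡ countCells (λ r c → P (suc r) (suc c))
countCells-inner P top left = trans (countCells-border P)
  (cong₂ (λ x y → x + (y + countCells (λ r c → P (suc r) (suc c))))
         (count-none _ top) (count-none _ left))

countCells-partition : ∀ {m n} (E : Fin m → Fin n → Fin n → Bool) (P : Fin n → Fin n → Bool) →
                       (∀ r c → count (λ i → E i r c) ≡ 1) →
                       sumFin (λ i → countCells (λ r c → E i r c ∧ P r c)) ≡ countCells P
countCells-partition E P once = begin
  sumFin (λ i → sumFin (λ r → count (λ c → E i r c ∧ P r c)))
    ≡⟨ sumFin-comm (λ i r → count (λ c → E i r c ∧ P r c)) ⟩
  sumFin (λ r → sumFin (λ i → count (λ c → E i r c ∧ P r c)))
    ≡⟨ sumFin-cong (λ r → sumFin-comm (λ i c → if E i r c ∧ P r c then 1 else 0)) ⟩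
  sumFin (λ r → sumFin (λ c → count (λ i → E i r c ∧ P r c)))
    ≡⟨ sumFin-cong (λ r → sumFin-cong (onePerCell r)) ⟩
  countCells P
    ∎
  where
  onePerCell : ∀ r c → count (λ i → E i r c ∧ P r c) ≡ (if P r c then 1 else 0)
  onePerCell r c =
    trans (count-∧ʳ (λ i → E i r c) (P r c)) (cong (λ k → if P r c then k else 0) (once r c))

binarySquare : ∀ {n} → (Fin n → Fin n → Bool) → Square n 2
binarySquare A r c = if A r c then suc zero else zero

literal : Fin 2 → Bool → Bool
literal zero       b = not b
literal (suc zero) b = b

≟-literal : ∀ b s → ⌊ (if b then suc zero else zero) ≟ s ⌋ ≡ literal s b
≟-literal false zero       = refl
≟-literal false (suc zero) = refl
≟-literal true  zero       = refl
≟-literal true  (suc zero) = refl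

count-literal : ∀ {k} (P : Fin (suc k) → Bool) → count P ≡ 1 →
                ∀ s → count (literal s ∘ P) ≡ binType (suc k) s
count-literal P P≡1 zero       = count-not P P≡1
count-literal P P≡1 (suc zero) = P≡1

binarySquare-isFreqSquare : ∀ {k} (A : Fin (suc (suc k)) → Fin (suc (suc k)) → Bool) →
                            (∀ r → count (A r) ≡ 1) → (∀ c → count (λ r → A r c) ≡ 1) →
                            IsFreqSquare (suc (suc k)) 2 (binType (suc (suc k))) (binarySquare A)
binarySquare-isFreqSquare {k} A rows columns =
  s≤s (s≤s z≤n) , positive , +-comm (suc k) 1 ,
  (λ r s → trans (count-cong (λ c → ≟-literal (A r c) s)) (count-literal (A r) (rows r) s)) ,
  (λ c s → trans (count-cong (λ r → ≟-literal (A r c) s)) (count-literal (λ r → A r c) (columns c) s))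
  where
  positive : ∀ s → 1 ≤ binType (suc (suc k)) s
  positive zero       = s≤s z≤n
  positive (suc zero) = s≤s z≤n

binarySquare-orthogonal : ∀ {k} (A B : Fin (suc k) → Fin (suc k) → Bool) →
                          (∀ r → count (A r) ≡ 1) → (∀ r → count (B r) ≡ 1) →
                          countCells (λ r c → A r c ∧ B r c) ≡ 1 →
                          Orthogonal (binarySquare A) (binarySquare B) (binType (suc k)) (binType (suc k))
binarySquare-orthogonal {k} A B rowsA rowsB meet s t =
  trans (countCells-cong (λ r c → cong₂ _∧_ (≟-literal (A r c) s) (≟-literal (B r c) t))) (pairs s t)
  where
  Cells : Set
  Cells = Fin (suc k) → Fin (suc k) → Bool

  onlyFirst : ∀ (P Q : Cells) → (∀ r → count (P r) ≡ 1) →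
              countCells (λ r c → P r c ∧ Q r c) ≡ 1 → countCells (λ r c → P r c ∧ not (Q r c)) ≡ k
  onlyFirst P Q rowsP meetPQ = suc-injective (begin
    suc P∖Q                                   ≡⟨ cong (_+ P∖Q) meetPQ ⟨
    countCells (λ r c → P r c ∧ Q r c) + P∖Q  ≡⟨ countCells-split P Q ⟨
    countCells P                              ≡⟨ sumFin-const rowsP ⟩
    suc k * 1                                 ≡⟨ *-identityʳ (suc k) ⟩
    suc k                                     ∎)
    where
    P∖Q : ℕ
    P∖Q = countCells (λ r c → P r c ∧ not (Q r c))

  onlySecond : countCells (λ r c → not (A r c) ∧ B r c) ≡ k
  onlySecond = begin
    countCells (λ r c → not (A r c) ∧ B r c)
      ≡⟨ countCells-cong (λ r c → ∧-comm (not (A r c)) (B r c)) ⟩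
    countCells (λ r c → B r c ∧ not (A r c))
      ≡⟨ onlyFirst B A rowsB meetBA ⟩
    k
      ∎
    where
    meetBA : countCells (λ r c → B r c ∧ A r c) ≡ 1
    meetBA = trans (countCells-cong (λ r c → ∧-comm (B r c) (A r c))) meet

  neither : countCells (λ r c → not (A r c) ∧ not (B r c)) ≡ k * k
  neither = +-cancelˡ-≡ k _ _ (begin
    k + none
      ≡⟨ cong (_+ none) onlySecond ⟨
    countCells (λ r c → not (A r c) ∧ B r c) + none
      ≡⟨ countCells-split (λ r c → not (A r c)) B ⟨
    countCells (λ r c → not (A r c))
      ≡⟨ sumFin-const (λ r → count-not (A r) (rowsA r)) ⟩
    suc k * k
      ∎)
    where
    none : ℕ
    none = countCells (λ r c → not (A r c) ∧ not (B r c))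

  pairs : ∀ s t → countCells (λ r c → literal s (A r c) ∧ literal t (B r c))
                  ≡ binType (suc k) s * binType (suc k) t
  pairs (suc zero) (suc zero) = meet
  pairs (suc zero) zero       = trans (onlyFirst A B rowsA meet) (sym (*-identityˡ k))
  pairs zero       (suc zero) = trans onlySecond (sym (*-identityʳ k))
  pairs zero       zero       = neither

graph : ∀ {n} → (ℕ → ℕ) → Fin n → Fin n → Bool
graph f r c = toℕ c ≡ᵇ f (toℕ r)

record PermutesBelow (n : ℕ) (f : ℕ → ℕ) : Set where
  field
    maps-below : ∀ {x} → x < n → f x < n
    injective  : ∀ {x y} → x < n → y < n → f x ≡ f y → x ≡ y
    surjective : ∀ {y} → y < n → ∃[ x ] x < n × f x ≡ y

open PermutesBelow

count-graph-row : ∀ {n f} → (∀ {x} → x < n → f x < n) → (r : Fin n) → count (graph f r) ≡ 1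
count-graph-row {n} {f} below r =
  count-unique {n} (_≡ᵇ f (toℕ r)) (below (toℕ<n r)) (≡⇒≡ᵇ (f (toℕ r)) _ refl)
                   (λ _ → ≡ᵇ⇒≡ _ _)

count-graph-column : ∀ {n f} → PermutesBelow n f → (c : Fin n) → count (λ r → graph f r c) ≡ 1
count-graph-column {n} {f} π c with surjective π (toℕ<n c)
... | x , x<n , fx≡c = count-unique {n} (λ y → toℕ c ≡ᵇ f y) x<n (≡⇒≡ᵇ _ _ (sym fx≡c))
  (λ y<n c≡fy → injective π y<n x<n (trans (sym (≡ᵇ⇒≡ _ _ c≡fy)) (sym fx≡c)))

graph-isFreqSquare : ∀ {k f} → PermutesBelow (suc (suc k)) f →
                     IsFreqSquare (suc (suc k)) 2 (binType (suc (suc k))) (binarySquare (graph f))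
graph-isFreqSquare {f = f} π =
  binarySquare-isFreqSquare (graph f) (count-graph-row (maps-below π)) (count-graph-column π)

countCells-graph-∧ : ∀ {m} (f g : ℕ → ℕ) → f 0 < suc m → f 0 ≡ g 0 →
                     (∀ {a} → a < m → f (suc a) ≢ g (suc a)) →
                     countCells {suc m} (λ r c → graph f r c ∧ graph g r c) ≡ 1
countCells-graph-∧ {m} f g f₀<n f₀≡g₀ differ =
  cong₂ _+_ firstRow (trans (sumFin-const otherRow) (*-zeroʳ m))
  where
  bothEqual : ∀ x u v → T ((x ≡ᵇ u) ∧ (x ≡ᵇ v)) → x ≡ u × x ≡ v
  bothEqual x u v t with to (T-∧ {x ≡ᵇ u}) t
  ... | x≡u , x≡v = ≡ᵇ⇒≡ x u x≡u , ≡ᵇ⇒≡ x v x≡v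

  firstRow : count {suc m} (λ c → graph f zero c ∧ graph g zero c) ≡ 1
  firstRow = count-unique {suc m} (λ x → (x ≡ᵇ f 0) ∧ (x ≡ᵇ g 0)) f₀<n
    (from T-∧ (≡⇒≡ᵇ (f 0) _ refl , ≡⇒≡ᵇ (f 0) _ f₀≡g₀)) (λ _ → proj₁ ∘ bothEqual _ _ _)

  otherRow : ∀ (r : Fin m) → count {suc m} (λ c → graph f (suc r) c ∧ graph g (suc r) c) ≡ 0
  otherRow r = count-none {suc m} _ (λ c t → let (c≡f , c≡g) = bothEqual (toℕ c) _ _ t in
                                             differ (toℕ<n r) (trans (sym c≡f) c≡g))

anotherSymbol : ∀ {k} → 2 ≤ k → (s : Fin k) → ∃[ t ] t ≢ s
anotherSymbol (s≤s (s≤s z≤n)) s = punchIn s zero , punchInᵢ≢i s zero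

noCommonOrthogonalMate : ∀ {m} (A : Fin m → Fin (suc m) → Fin (suc m) → Bool) →
                         (∀ i c → A i zero (suc c) ≡ false) → (∀ i r → A i (suc r) zero ≡ false) →
                         (∀ r c → count (λ i → A i (suc r) (suc c)) ≡ 1) →
                         ∀ {k mu} {G : Square (suc m) k} → IsFreqSquare (suc m) k mu G →
                         ¬ (∀ i → Orthogonal (binarySquare (A i)) G (binType (suc m)) mu)
noCommonOrthogonalMate {m} A topRow leftColumn once {k} {mu} {G}
                       (2≤k , positive , _ , rows , columns) orthogonal = <⇒≢ (positive j) (sym μ≡0)
  where
  j : Fin k
  j = proj₁ (anotherSymbol 2≤k (G zero zero))

  μ : ℕ
  μ = mu j

  g : Fin (suc m) → Fin (suc m) → Bool
  g r c = ⌊ G r c ≟ j ⌋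

  g₀₀ : g zero zero ≡ false
  g₀₀ = trans (isYes≗does (G zero zero ≟ j))
              (dec-false (G zero zero ≟ j) (proj₂ (anotherSymbol 2≤k (G zero zero)) ∘ sym))

  inner : (Fin (suc m) → Fin (suc m) → Bool) → ℕ
  inner P = countCells (λ r c → P (suc r) (suc c))

  meets : ∀ i → inner (λ r c → A i r c ∧ g r c) ≡ μ
  meets i = begin
    inner P                                                             ≡⟨ countCells-inner P top left ⟨
    countCells P                                                        ≡⟨ countCells-cong literal₁ ⟨
    countCells (λ r c → ⌊ binarySquare (A i) r c ≟ suc zero ⌋ ∧ g r c)  ≡⟨ orthogonal i (suc zero) j ⟩
    1 * μ                                                               ≡⟨ *-identityˡ μ ⟩
    μ                                                                   ∎
    where
    P : Fin (suc m) → Fin (suc m) → Bool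
    P r c = A i r c ∧ g r c

    literal₁ : ∀ r c → ⌊ binarySquare (A i) r c ≟ suc zero ⌋ ∧ g r c ≡ A i r c ∧ g r c
    literal₁ r c = cong (_∧ g r c) (≟-literal (A i r c) (suc zero))

    top : ∀ c → ¬ T (A i zero c ∧ g zero c)
    top zero    = subst T (trans (cong (A i zero zero ∧_) g₀₀) (∧-zeroʳ (A i zero zero)))
    top (suc c) = subst T (cong (_∧ g zero (suc c)) (topRow i c))

    left : ∀ r → ¬ T (A i (suc r) zero ∧ g (suc r) zero)
    left r = subst T (cong (_∧ g (suc r) zero) (leftColumn i r))

  leftOfG : count (λ r → g (suc r) zero) ≡ μ
  leftOfG = begin
    count (λ r → g (suc r) zero)
      ≡⟨ cong (λ b → (if b then 1 else 0) + count (λ r → g (suc r) zero)) g₀₀ ⟨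
    count (λ r → g r zero)
      ≡⟨ columns zero j ⟩
    μ
      ∎

  blockOfG : m * μ ≡ inner g
  blockOfG = begin
    m * μ
      ≡⟨ sumFin-const meets ⟨
    sumFin (λ i → inner (λ r c → A i r c ∧ g r c))
      ≡⟨ countCells-partition (λ i r c → A i (suc r) (suc c)) (λ r c → g (suc r) (suc c)) once ⟩
    inner g
      ∎

  μ≡0 : μ ≡ 0
  μ≡0 = sym (+-cancelʳ-≡ (m * μ) 0 μ (+-cancelˡ-≡ μ _ _ (begin
    suc m * μ
      ≡⟨ sumFin-const (λ r → rows r j) ⟨
    countCells g
      ≡⟨ countCells-border g ⟩
    count (g zero) + (count (λ r → g (suc r) zero) + inner g)
      ≡⟨ cong₂ (λ x y → x + (y + inner g)) (rows zero j) leftOfG ⟩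
    μ + (μ + inner g)
      ≡⟨ cong (λ x → μ + (μ + x)) blockOfG ⟨
    μ + (μ + m * μ)
      ∎)))

[m+n%d]%d≡[m+n]%d : ∀ m n d .{{_ : NonZero d}} → (m + n % d) % d ≡ (m + n) % d
[m+n%d]%d≡[m+n]%d m n d = begin
  (m + n % d) % d          ≡⟨ %-distribˡ-+ m (n % d) d ⟩
  (m % d + n % d % d) % d  ≡⟨ cong (λ x → (m % d + x) % d) (m%n%n≡m%n n d) ⟩
  (m % d + n % d) % d      ≡⟨ %-distribˡ-+ m n d ⟨
  (m + n) % d              ∎

d∣[d∸m%d]+m : ∀ m d .{{_ : NonZero d}} → d ∣ (d ∸ m % d) + m
d∣[d∸m%d]+m m d = m%n≡0⇒n∣m _ d (begin
  (d ∸ m % d + m) % d      ≡⟨ [m+n%d]%d≡[m+n]%d (d ∸ m % d) m d ⟨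
  (d ∸ m % d + m % d) % d  ≡⟨ %-congˡ (m∸n+n≡m (m%n≤n m d)) ⟩
  d % d                    ≡⟨ n%n≡0 d ⟩
  0                        ∎)

+-%-cancelˡ : ∀ a {x y} d .{{_ : NonZero d}} → x < d → y < d → (a + x) % d ≡ (a + y) % d → x ≡ y
+-%-cancelˡ a {x} {y} d x<d y<d eq = begin
  x                                  ≡⟨ subtract x<d ⟨
  (d ∸ a % d + (a + x) % d) % d      ≡⟨ cong (λ z → (d ∸ a % d + z) % d) eq ⟩
  (d ∸ a % d + (a + y) % d) % d      ≡⟨ subtract y<d ⟩
  y                                  ∎
  where
  subtract : ∀ {z} → z < d → (d ∸ a % d + (a + z) % d) % d ≡ z
  subtract {z} z<d = begin
    (d ∸ a % d + (a + z) % d) % d    ≡⟨ [m+n%d]%d≡[m+n]%d (d ∸ a % d) (a + z) d ⟩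
    (d ∸ a % d + (a + z)) % d        ≡⟨ %-congˡ (+-assoc (d ∸ a % d) a z) ⟨
    (d ∸ a % d + a + z) % d          ≡⟨ %-remove-+ˡ z (d∣[d∸m%d]+m a d) ⟩
    z % d                            ≡⟨ m<n⇒m%n≡m z<d ⟩
    z                                ∎

+-%-cancelʳ : ∀ a {x y} d .{{_ : NonZero d}} → x < d → y < d → (x + a) % d ≡ (y + a) % d → x ≡ y
+-%-cancelʳ a {x} {y} d x<d y<d eq =
  +-%-cancelˡ a d x<d y<d (trans (%-congˡ (+-comm a x)) (trans eq (%-congˡ (+-comm y a))))

+-%-solvableʳ : ∀ a {b} d .{{_ : NonZero d}} → b < d → ∃[ x ] x < d × (x + a) % d ≡ b
+-%-solvableʳ a {b} d b<d = x , m%n<n (d ∸ a % d + b) d , (begin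
  ((d ∸ a % d + b) % d + a) % d  ≡⟨ %-congˡ (+-comm _ a) ⟩
  (a + (d ∸ a % d + b) % d) % d  ≡⟨ [m+n%d]%d≡[m+n]%d a (d ∸ a % d + b) d ⟩
  (a + (d ∸ a % d + b)) % d      ≡⟨ %-congˡ (+-assoc a (d ∸ a % d) b) ⟨
  (a + (d ∸ a % d) + b) % d      ≡⟨ %-congˡ (cong (_+ b) (+-comm a (d ∸ a % d))) ⟩
  (d ∸ a % d + a + b) % d        ≡⟨ %-remove-+ˡ b (d∣[d∸m%d]+m a d) ⟩
  b % d                          ≡⟨ m<n⇒m%n≡m b<d ⟩
  b                              ∎)
  where
  x : ℕ
  x = (d ∸ a % d + b) % d

sigma-suc : ∀ m .{{_ : NonZero m}} {a} → a < m → sigma (suc m) (suc a) ≡ suc (suc a % m)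
sigma-suc m {a} a<m with suc a <ᵇ m in 1+a<ᵇm
... | true  = cong suc (sym (m<n⇒m%n≡m (<ᵇ⇒< (suc a) m (subst T (sym 1+a<ᵇm) tt))))
... | false = cong suc (sym (trans (%-congˡ 1+a≡m) (n%n≡0 m)))
  where
  1+a≡m : suc a ≡ m
  1+a≡m = ≤-antisym a<m (≮⇒≥ (λ 1+a<m → subst T 1+a<ᵇm (<⇒<ᵇ 1+a<m)))

sigmaPow-zero : ∀ n i → sigmaPow n i 0 ≡ 0
sigmaPow-zero n zero    = refl
sigmaPow-zero n (suc i) = cong (sigma n) (sigmaPow-zero n i)

sigmaPow-suc : ∀ m .{{_ : NonZero m}} i {a} → a < m → sigmaPow (suc m) i (suc a) ≡ suc ((i + a) % m)
sigmaPow-suc m zero    a<m = cong suc (sym (m<n⇒m%n≡m a<m))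
sigmaPow-suc m (suc i) {a} a<m = begin
  sigma (suc m) (sigmaPow (suc m) i (suc a))  ≡⟨ cong (sigma (suc m)) (sigmaPow-suc m i a<m) ⟩
  sigma (suc m) (suc ((i + a) % m))           ≡⟨ sigma-suc m (m%n<n (i + a) m) ⟩
  suc (suc ((i + a) % m) % m)                 ≡⟨ cong suc ([m+n%d]%d≡[m+n]%d 1 (i + a) m) ⟩
  suc (suc (i + a) % m)                       ∎

sigmaPow-permutes : ∀ m .{{_ : NonZero m}} i → PermutesBelow (suc m) (sigmaPow (suc m) i)
sigmaPow-permutes m i = record { maps-below = below ; injective = inj ; surjective = surj }
  where
  σⁱ : ℕ → ℕ
  σⁱ = sigmaPow (suc m) i

  below : ∀ {x} → x < suc m → σⁱ x < suc m
  below {zero}  _         = subst (_< suc m) (sym (sigmaPow-zero (suc m) i)) z<s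
  below {suc a} (s<s a<m) = subst (_< suc m) (sym (sigmaPow-suc m i a<m)) (s<s (m%n<n (i + a) m))

  inj : ∀ {x y} → x < suc m → y < suc m → σⁱ x ≡ σⁱ y → x ≡ y
  inj {zero}  {zero}  _         _         _   = refl
  inj {zero}  {suc b} _         (s<s b<m) eq  =
    contradiction (trans (sym (sigmaPow-zero (suc m) i)) (trans eq (sigmaPow-suc m i b<m))) 0≢1+n
  inj {suc a} {zero}  (s<s a<m) _         eq  =
    contradiction (trans (sym (sigmaPow-suc m i a<m)) (trans eq (sigmaPow-zero (suc m) i))) 1+n≢0
  inj {suc a} {suc b} (s<s a<m) (s<s b<m) eq  = cong suc (+-%-cancelˡ i m a<m b<m
    (suc-injective (trans (sym (sigmaPow-suc m i a<m)) (trans eq (sigmaPow-suc m i b<m)))))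

  surj : ∀ {y} → y < suc m → ∃[ x ] x < suc m × σⁱ x ≡ y
  surj {zero}  _         = 0 , z<s , sigmaPow-zero (suc m) i
  surj {suc b} (s<s b<m) with +-%-solvableʳ i m b<m
  ... | a , a<m , a+i≡b = suc a , s<s a<m ,
        trans (sigmaPow-suc m i a<m) (cong suc (trans (%-congˡ (+-comm i a)) a+i≡b))

sigmaPow-latin : ∀ m .{{_ : NonZero m}} (r c : Fin m) →
                 count (λ (i : Fin m) → graph (sigmaPow (suc m) (toℕ i)) (suc r) (suc c)) ≡ 1
sigmaPow-latin m r c with +-%-solvableʳ (toℕ r) m (toℕ<n c)
... | x , x<m , x+r≡c = trans
  (count-cong {m} (λ i → cong (suc (toℕ c) ≡ᵇ_) (sigmaPow-suc m (toℕ i) (toℕ<n r))))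
  (count-unique {m} (λ i → toℕ c ≡ᵇ (i + toℕ r) % m) x<m (≡⇒≡ᵇ _ _ (sym x+r≡c))
    (λ y<m c≡y+r → +-%-cancelʳ (toℕ r) m y<m x<m (trans (sym (≡ᵇ⇒≡ _ _ c≡y+r)) (sym x+r≡c))))

sigmaPow-distinct : ∀ m .{{_ : NonZero m}} {i j a} → i < m → j < m → i ≢ j → a < m →
                    sigmaPow (suc m) i (suc a) ≢ sigmaPow (suc m) j (suc a)
sigmaPow-distinct m {i} {j} i<m j<m i≢j a<m eq = i≢j (+-%-cancelʳ _ m i<m j<m
  (suc-injective (trans (sym (sigmaPow-suc m i a<m)) (trans eq (sigmaPow-suc m j a<m)))))

permSq-isFreqSquare : ∀ p i →
                      IsFreqSquare (suc (suc p)) 2 (binType (suc (suc p))) (permSq (suc (suc p)) i)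
permSq-isFreqSquare p i = graph-isFreqSquare (sigmaPow-permutes (suc p) i)

permSq-orthogonal : ∀ p i j → i ≤ p → j ≤ p → i ≢ j →
                    Orthogonal (permSq (suc (suc p)) i) (permSq (suc (suc p)) j)
                               (binType (suc (suc p))) (binType (suc (suc p)))
permSq-orthogonal p i j i≤p j≤p i≢j =
  binarySquare-orthogonal (graph σⁱ) (graph σʲ)
    (count-graph-row (maps-below (sigmaPow-permutes (suc p) i)))
    (count-graph-row (maps-below (sigmaPow-permutes (suc p) j)))
    (countCells-graph-∧ σⁱ σʲ (maps-below (sigmaPow-permutes (suc p) i) z<s)
                        (trans (sigmaPow-zero _ i) (sym (sigmaPow-zero _ j)))
                        (sigmaPow-distinct (suc p) (s≤s i≤p) (s≤s j≤p) i≢j))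
  where
  σⁱ σʲ : ℕ → ℕ
  σⁱ = sigmaPow (suc (suc p)) i
  σʲ = sigmaPow (suc (suc p)) j

permSq-maximal : ∀ p {k mu} {G : Square (suc (suc p)) k} → IsFreqSquare (suc (suc p)) k mu G →
                 ¬ (∀ i → i ≤ p → Orthogonal (permSq (suc (suc p)) i) G (binType (suc (suc p))) mu)
permSq-maximal p {G = G} G-freq G-orthogonal =
  noCommonOrthogonalMate (λ i → graph (sigmaPow (suc (suc p)) (toℕ i)))
    (λ i c → cong (suc (toℕ c) ≡ᵇ_) (sigmaPow-zero _ (toℕ i)))
    (λ i r → cong (0 ≡ᵇ_) (sigmaPow-suc (suc p) (toℕ i) (toℕ<n r)))
    (sigmaPow-latin (suc p)) {G = G} G-freq (λ i → G-orthogonal (toℕ i) (toℕ≤pred[n] i))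

-- The argument never uses that n is square-free.
theorem2p5 : (n : ℕ) → 1 < n → SquareFree n →
    ((i : ℕ) → i ≤ n ∸ 2 → IsFreqSquare n 2 (binType n) (permSq n i))
    × ((i j : ℕ) → i ≤ n ∸ 2 → j ≤ n ∸ 2 → i ≢ j →
        Orthogonal (permSq n i) (permSq n j) (binType n) (binType n))
    × ¬ (Σ ℕ λ m → Σ (Fin m → ℕ) λ mu → Σ (Square n m) λ G →
          IsFreqSquare n m mu G
          × ((i : ℕ) → i ≤ n ∸ 2 → Orthogonal (permSq n i) G (binType n) mu))
theorem2p5 (suc zero) (s≤s ()) _
theorem2p5 (suc (suc p)) _ _ =
    (λ i _ → permSq-isFreqSquare p i)
  , permSq-orthogonal p
  , λ (_ , _ , G , G-freq , G-orthogonal) → permSq-maximal p {G = G} G-freq G-orthogonal
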